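{- For every integer $n\geqslant 0$, $$p(n) = \sum_{k=3}^{n+3} P_{\phi}(k)\, S^{(3)}_{n+3,k},$$ where $P_\phi(k)=\phi(k)/2$.
   Context: $p(n)$ is the number of partitions of $n$, with $p(0)=1$. A partition of a positive integer $m$ is a nonincreasing sequence of positive integers (its parts) summing to $m$. For integers $r\ge 1$, $k\ge 1$, $m\ge 1$, $S^{(r)}_{m,k}$ denotes the number of parts equal to $k$ (counted with multiplicity) summed over all partitions of $m$ whose smallest part is at least $r$. $\phi$ is Euler's totient function, and $P_\phi(k)=\phi(k)/2$ (for $k>2$ this equals the number of partitions of $k$ into two relatively prime parts). -}

module Defs where

open import Data.Nat using (ℕ; zero; suc; _+_; _*_; _∸_; _/_; _≤ᵇ_; _≡ᵇ_)
open import Data.Nat.GCD using (gcd)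
open import Data.List using (List; []; _∷_; length; map; filter; concatMap; applyUpTo)
open import Data.Nat.ListAction using (sum)
open import Data.Bool using (Bool; true; false; if_then_else_)

-- Partitions of m all of whose parts are ≤ b, as nonincreasing lists of
-- positive integers (parts listed in nonincreasing order).
-- partsBounded fuel m b ; fuel = m suffices (each step removes a part ≥ 1).
partsBounded : ℕ → ℕ → ℕ → List (List ℕ)
partsBounded _ zero _ = [] ∷ []
partsBounded zero (suc _) _ = []
partsBounded (suc f) m b =
  concatMap (λ k → map (k ∷_) (partsBounded f (m ∸ k) k))
            (filter (λ k → k Data.Nat.≤? m) (applyUpTo suc b))
  where import Data.Nat

partitions : ℕ → List (List ℕ)
partitions m = partsBounded m m m

p : ℕ → ℕ
p n = length (partitions n)

count : ℕ → List ℕ → ℕ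
count k [] = 0
count k (x ∷ xs) = (if x ≡ᵇ k then 1 else 0) + count k xs

minAtLeast : ℕ → List ℕ → Bool
minAtLeast r [] = true
minAtLeast r (x ∷ xs) = if r ≤ᵇ x then minAtLeast r xs else false

S : ℕ → ℕ → ℕ → ℕ
S r m k = sum (map (count k) (filter (λ λs → Data.Bool.T? (minAtLeast r λs)) (partitions m)))
  where import Data.Bool

φ : ℕ → ℕ
φ k = length (filter (λ i → gcd i k Data.Nat.≟ 1) (applyUpTo suc k))
  where import Data.Nat

Pφ : ℕ → ℕ
Pφ k = φ k / 2

sumFromTo : ℕ → ℕ → (ℕ → ℕ) → ℕ
sumFromTo a b f = sum (map f (applyUpTo (λ i → a + i) (suc b ∸ a)))

-- Read sequences ℕ → ℕ as power series in q. Partitions into parts ≤ b have generating function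
-- ∏_{j ≤ b} 1/(1 − q^j), and the number of parts equal to k, summed over the partitions into parts
-- from [3, b], has generating function [k ≤ b] q^k/(1 − q^k) ∏_{3 ≤ j ≤ b} 1/(1 − q^j). The
-- right-hand side is therefore the coefficient of q^(n+3) in (∑_{k ≥ 3} Pφ(k) q^k/(1 − q^k)) ∏_{j ≥ 3} 1/(1 − q^j).
-- The coefficient of q^t in this Lambert series is ∑_{3 ≤ d ∣ t} φ(d)/2, which by Gauss's
-- ∑_{d ∣ t} φ(d) = t and the evenness of φ(d) for d ≥ 3 equals ⌊(t − 1)/2⌋, the coefficient of q^t in
-- q^3/((1 − q)(1 − q^2)). The product is thus q^3 ∏_{j ≥ 1} 1/(1 − q^j), whose coefficient of q^(n+3) is p(n).

module Submission where

open import Defs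
open import Data.Nat using (ℕ; _+_; _*_)
open import Relation.Binary.PropositionalEquality using (_≡_)

open import Data.Nat using (zero; suc; _∸_; _≤_; _<_; z≤n; s≤s; z<s; s<s; s≤s⁻¹; _≤?_; _≟_; NonZero; ≢-nonZero)
open import Data.Nat.Properties
open import Data.Nat.Divisibility
  using (_∣_; divides; _∣?_; ∣-antisym; _∣0; 1∣_; ∣-refl; ∣⇒≤; ∣m+n∣m⇒∣n; ∣m∣n⇒∣m+n; ∣m∸n∣n⇒∣m; n∣m*n)
open import Data.Nat.DivMod using (m*[n/m]≡n)
open import Data.Nat.GCD using (gcd; gcd[m,n]∣m; gcd[m,n]∣n; gcd-greatest; gcd-identityˡ; gcd[m,n]≢0; c*gcd[m,n]≡gcd[cm,cn])
open import Data.Nat.Induction using (<-rec)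
open import Data.Nat.ListAction using (sum)
open import Data.Nat.ListAction.Properties using (sum-++)
open import Algebra.Properties.CommutativeSemigroup +-commutativeSemigroup using (interchange)
open import Algebra.Properties.CommutativeSemigroup *-commutativeSemigroup using (x∙yz≈y∙xz)
open import Data.Bool using (true; false; if_then_else_; T?)
open import Data.Empty using (⊥-elim)
open import Data.List using (List; []; _∷_; _++_; length; map; filter; concatMap; applyUpTo)
open import Data.List.Properties using (length-++; length-map; filter-++; filter-accept; filter-reject; map-++)
open import Data.Product using (_,_; ∃-syntax)
open import Data.Sum using (_⊎_; inj₁; inj₂)
open import Function using (_∘_)
open import Relation.Binary.Definitions using (tri<; tri≈; tri>)
open import Relation.Binary.PropositionalEquality using (refl; sym; trans; cong; cong₂; subst; module ≡-Reasoning)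
open import Relation.Nullary using (Dec; does; yes; no; ¬_)
open import Relation.Unary using (Pred; Decidable)
open ≡-Reasoning

𝟙 : ∀ {P : Set} → Dec P → ℕ
𝟙 P? = if does P? then 1 else 0

𝟙-yes : ∀ {P : Set} (P? : Dec P) → P → 𝟙 P? ≡ 1
𝟙-yes (yes _) _ = refl
𝟙-yes (no ¬p) p = ⊥-elim (¬p p)

𝟙-no : ∀ {P : Set} (P? : Dec P) → ¬ P → 𝟙 P? ≡ 0
𝟙-no (yes p) ¬p = ⊥-elim (¬p p)
𝟙-no (no _)  _  = refl

𝟙-cong : ∀ {P Q : Set} (P? : Dec P) (Q? : Dec Q) → (P → Q) → (Q → P) → 𝟙 P? ≡ 𝟙 Q?
𝟙-cong (yes _) (yes _) _   _   = refl
𝟙-cong (yes p) (no ¬q) P→Q _   = ⊥-elim (¬q (P→Q p))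
𝟙-cong (no ¬p) (yes q) _   Q→P = ⊥-elim (¬p (Q→P q))
𝟙-cong (no _)  (no _)  _   _   = refl

-- Finite sums

∑ : ℕ → (ℕ → ℕ) → ℕ
∑ zero    f = 0
∑ (suc n) f = f 0 + ∑ n (f ∘ suc)

∑-cong : ∀ n {f g : ℕ → ℕ} → (∀ i → i < n → f i ≡ g i) → ∑ n f ≡ ∑ n g
∑-cong zero    _   = refl
∑-cong (suc n) f≗g = cong₂ _+_ (f≗g 0 z<s) (∑-cong n (λ i i<n → f≗g (suc i) (s<s i<n)))

∑-zero : ∀ n {f : ℕ → ℕ} → (∀ i → i < n → f i ≡ 0) → ∑ n f ≡ 0
∑-zero zero    _    = refl
∑-zero (suc n) f≗0 = cong₂ _+_ (f≗0 0 z<s) (∑-zero n (λ i i<n → f≗0 (suc i) (s<s i<n)))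

∑-distrib-+ : ∀ n (f g : ℕ → ℕ) → ∑ n (λ i → f i + g i) ≡ ∑ n f + ∑ n g
∑-distrib-+ zero    f g = refl
∑-distrib-+ (suc n) f g = trans (cong (f 0 + g 0 +_) (∑-distrib-+ n (f ∘ suc) (g ∘ suc)))
                                (interchange (f 0) (g 0) _ _)

*-distribˡ-∑ : ∀ n c (f : ℕ → ℕ) → c * ∑ n f ≡ ∑ n (λ i → c * f i)
*-distribˡ-∑ zero    c f = *-zeroʳ c
*-distribˡ-∑ (suc n) c f = trans (*-distribˡ-+ c (f 0) _) (cong (c * f 0 +_) (*-distribˡ-∑ n c (f ∘ suc)))

∑-suc : ∀ n (f : ℕ → ℕ) → ∑ (suc n) f ≡ ∑ n f + f n
∑-suc zero    f = +-comm (f 0) 0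
∑-suc (suc n) f = trans (cong (f 0 +_) (∑-suc n (f ∘ suc))) (sym (+-assoc (f 0) _ _))

∑-telescope : ∀ (g t : ℕ → ℕ) → g 0 ≡ 0 → (∀ b → g (suc b) ≡ g b + t b) → ∀ b → ∑ b t ≡ g b
∑-telescope g t g0≡0 g-suc zero    = sym g0≡0
∑-telescope g t g0≡0 g-suc (suc b) =
  trans (∑-suc b t) (trans (cong (_+ t b) (∑-telescope g t g0≡0 g-suc b)) (sym (g-suc b)))

∑-+ : ∀ a b (f : ℕ → ℕ) → ∑ (a + b) f ≡ ∑ a f + ∑ b (λ i → f (a + i))
∑-+ zero    b f = refl
∑-+ (suc a) b f = trans (cong (f 0 +_) (∑-+ a b (f ∘ suc))) (sym (+-assoc (f 0) _ _))

∑-* : ∀ a b (f : ℕ → ℕ) → ∑ (a * b) f ≡ ∑ a (λ q → ∑ b (λ r → f (q * b + r)))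
∑-* zero    b f = refl
∑-* (suc a) b f = begin
  ∑ (b + a * b) f                                       ≡⟨ ∑-+ b (a * b) f ⟩
  ∑ b f + ∑ (a * b) (λ i → f (b + i))                   ≡⟨ cong (∑ b f +_) (∑-* a b (λ i → f (b + i))) ⟩
  ∑ b f + ∑ a (λ q → ∑ b (λ r → f (b + (q * b + r))))   ≡⟨ cong (∑ b f +_) (∑-cong a (λ q _ →
                                                            ∑-cong b (λ r _ → cong f (sym (+-assoc b (q * b) r))))) ⟩
  ∑ b f + ∑ a (λ q → ∑ b (λ r → f (b + q * b + r)))     ∎

∑-comm : ∀ n m (f : ℕ → ℕ → ℕ) → ∑ n (λ i → ∑ m (f i)) ≡ ∑ m (λ j → ∑ n (λ i → f i j))
∑-comm zero    m f = sym (∑-zero m (λ _ _ → refl))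
∑-comm (suc n) m f = trans (cong (∑ m (f 0) +_) (∑-comm n m (f ∘ suc)))
                           (sym (∑-distrib-+ m (f 0) (λ j → ∑ n (λ i → f (suc i) j))))

∑-reverse : ∀ n (f : ℕ → ℕ) → ∑ n f ≡ ∑ n (λ i → f (n ∸ suc i))
∑-reverse zero    f = refl
∑-reverse (suc n) f = begin
  f 0 + ∑ n (f ∘ suc)                          ≡⟨ cong (f 0 +_) (∑-reverse n (f ∘ suc)) ⟩
  f 0 + ∑ n (λ i → f (suc (n ∸ suc i)))        ≡⟨ cong (f 0 +_) (∑-cong n (λ i i<n → cong f (sym (+-∸-assoc 1 i<n)))) ⟩
  f 0 + ∑ n (λ i → f (suc n ∸ suc i))          ≡⟨ +-comm (f 0) _ ⟩
  ∑ n (λ i → f (suc n ∸ suc i)) + f 0          ≡⟨ cong (λ j → ∑ n (λ i → f (suc n ∸ suc i)) + f j) (sym (n∸n≡0 n)) ⟩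
  ∑ n (λ i → f (suc n ∸ suc i)) + f (n ∸ n)    ≡⟨ sym (∑-suc n (λ i → f (suc n ∸ suc i))) ⟩
  ∑ (suc n) (λ i → f (suc n ∸ suc i))          ∎

∑-const-1 : ∀ n → ∑ n (λ _ → 1) ≡ n
∑-const-1 zero    = refl
∑-const-1 (suc n) = cong suc (∑-const-1 n)

∑-𝟙-≡ : ∀ n q → q < n → ∑ n (λ k → 𝟙 (k ≟ q)) ≡ 1
∑-𝟙-≡ (suc n) zero    _       = cong suc (∑-zero n (λ i _ → 𝟙-no (suc i ≟ 0) (λ ())))
∑-𝟙-≡ (suc n) (suc q) (s<s q<n) =
  trans (∑-cong n (λ i _ → 𝟙-cong (suc i ≟ suc q) (i ≟ q) suc-injective (cong suc))) (∑-𝟙-≡ n q q<n)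

sum-map-applyUpTo : ∀ (f g : ℕ → ℕ) n → sum (map f (applyUpTo g n)) ≡ ∑ n (f ∘ g)
sum-map-applyUpTo f g zero    = refl
sum-map-applyUpTo f g (suc n) = cong (f (g 0) +_) (sum-map-applyUpTo f (g ∘ suc) n)

length-filter-applyUpTo : ∀ {P : Pred ℕ _} (P? : Decidable P) (g : ℕ → ℕ) n →
                          length (filter P? (applyUpTo g n)) ≡ ∑ n (λ i → 𝟙 (P? (g i)))
length-filter-applyUpTo P? g zero = refl
length-filter-applyUpTo P? g (suc n) with P? (g 0)
... | yes _ = cong suc (length-filter-applyUpTo P? (g ∘ suc) n)
... | no  _ = length-filter-applyUpTo P? (g ∘ suc) n

∑[n+n]-palindrome : ∀ a (h : ℕ → ℕ) → (∀ j → j < a → h (a + a ∸ suc j) ≡ h j) → ∑ (a + a) h ≡ 2 * ∑ a h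
∑[n+n]-palindrome a h sym-h = begin
  ∑ (a + a) h                                   ≡⟨ ∑-+ a a h ⟩
  ∑ a h + ∑ a (λ i → h (a + i))                 ≡⟨ cong (∑ a h +_) (∑-reverse a (λ i → h (a + i))) ⟩
  ∑ a h + ∑ a (λ i → h (a + (a ∸ suc i)))       ≡⟨ cong (∑ a h +_) (∑-cong a (λ i i<a →
                                                     trans (cong h (sym (+-∸-assoc a i<a))) (sym-h i i<a))) ⟩
  ∑ a h + ∑ a h                                 ≡⟨ cong (∑ a h +_) (sym (+-identityʳ (∑ a h))) ⟩
  2 * ∑ a h                                     ∎

∑[1+n+n]-palindrome : ∀ c (h : ℕ → ℕ) → h c ≡ 0 → (∀ j → j < c → h (c + c ∸ j) ≡ h j) →
                   ∑ (suc (c + c)) h ≡ 2 * ∑ c h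
∑[1+n+n]-palindrome c h h[c]≡0 sym-h = begin
  ∑ (suc (c + c)) h                                     ≡⟨ cong (λ n → ∑ n h) (sym (+-suc c c)) ⟩
  ∑ (c + suc c) h                                       ≡⟨ ∑-+ c (suc c) h ⟩
  ∑ c h + (h (c + 0) + ∑ c (λ j → h (c + suc j)))       ≡⟨ cong₂ (λ x y → ∑ c h + (x + y))
                                                             (trans (cong h (+-identityʳ c)) h[c]≡0)
                                                             (∑-reverse c (λ j → h (c + suc j))) ⟩
  ∑ c h + ∑ c (λ j → h (c + suc (c ∸ suc j)))           ≡⟨ cong (∑ c h +_) (∑-cong c (λ j j<c →
                                                             trans (cong h (mirror j<c)) (sym-h j j<c))) ⟩
  ∑ c h + ∑ c h                                         ≡⟨ cong (∑ c h +_) (sym (+-identityʳ (∑ c h))) ⟩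
  2 * ∑ c h                                             ∎
  where
  mirror : ∀ {j} → j < c → c + suc (c ∸ suc j) ≡ c + c ∸ j
  mirror j<c = trans (cong (c +_) (sym (+-∸-assoc 1 j<c))) (sym (+-∸-assoc c (<⇒≤ j<c)))

-- Power series

Series : Set
Series = ℕ → ℕ

infixl 7 _⋆_
_⋆_ : Series → Series → Series
(f ⋆ g) m = ∑ (suc m) (λ i → f i * g (m ∸ i))

δ : Series
δ zero    = 1
δ (suc _) = 0

-- multiplication by q^c
shift : ℕ → Series → Series
shift zero    h i       = h i
shift (suc c) h zero    = 0
shift (suc c) h (suc i) = shift c h i

shift-≤ : ∀ c (h : Series) {m} → c ≤ m → shift c h m ≡ h (m ∸ c)
shift-≤ zero    h _         = refl
shift-≤ (suc c) h (s≤s c≤m) = shift-≤ c h c≤m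

shift-< : ∀ c (h : Series) {m} → m < c → shift c h m ≡ 0
shift-< (suc c) h {zero}  _         = refl
shift-< (suc c) h {suc m} (s<s m<c) = shift-< c h m<c

shift-cong : ∀ c {h h′ : Series} → (∀ i → h i ≡ h′ i) → ∀ m → shift c h m ≡ shift c h′ m
shift-cong zero    h≗h′ m       = h≗h′ m
shift-cong (suc c) h≗h′ zero    = refl
shift-cong (suc c) h≗h′ (suc m) = shift-cong c h≗h′ m

shift≡𝟙* : ∀ c (h : Series) m → shift c h m ≡ 𝟙 (c ≤? m) * h (m ∸ c)
shift≡𝟙* c h m with c ≤? m
... | yes c≤m = trans (shift-≤ c h c≤m) (sym (trans (cong (_* h (m ∸ c)) (𝟙-yes (c ≤? m) c≤m)) (+-identityʳ _)))
... | no  c≰m = trans (shift-< c h (≰⇒> c≰m)) (sym (cong (_* h (m ∸ c)) (𝟙-no (c ≤? m) c≰m)))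

⋆-congˡ : ∀ {f f′ : Series} g m → (∀ i → f i ≡ f′ i) → (f ⋆ g) m ≡ (f′ ⋆ g) m
⋆-congˡ g m f≗f′ = ∑-cong (suc m) (λ i _ → cong (_* g (m ∸ i)) (f≗f′ i))

⋆-congʳ : ∀ f {g g′ : Series} m → (∀ i → i ≤ m → g i ≡ g′ i) → (f ⋆ g) m ≡ (f ⋆ g′) m
⋆-congʳ f m g≗g′ = ∑-cong (suc m) (λ i _ → cong (f i *_) (g≗g′ (m ∸ i) (m∸n≤m m i)))

⋆-distribʳ-+ : ∀ (f h g : Series) m → ((λ i → f i + h i) ⋆ g) m ≡ (f ⋆ g) m + (h ⋆ g) m
⋆-distribʳ-+ f h g m = trans (∑-cong (suc m) (λ i _ → *-distribʳ-+ (g (m ∸ i)) (f i) (h i)))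
                             (∑-distrib-+ (suc m) (λ i → f i * g (m ∸ i)) (λ i → h i * g (m ∸ i)))

⋆-identityˡ : ∀ (g : Series) m → (δ ⋆ g) m ≡ g m
⋆-identityˡ g m = trans (cong (g m + 0 +_) (∑-zero m (λ _ _ → refl))) (trans (+-identityʳ _) (+-identityʳ (g m)))

shift-⋆ : ∀ c (h g : Series) m → (shift c h ⋆ g) m ≡ shift c (h ⋆ g) m
shift-⋆ zero    h g m       = refl
shift-⋆ (suc c) h g zero    = refl
shift-⋆ (suc c) h g (suc m) = shift-⋆ c h g m

⋆-comm : ∀ (f g : Series) m → (f ⋆ g) m ≡ (g ⋆ f) m
⋆-comm f g m = begin
  ∑ (suc m) (λ i → f i * g (m ∸ i))                   ≡⟨ ∑-reverse (suc m) (λ i → f i * g (m ∸ i)) ⟩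
  ∑ (suc m) (λ i → f (m ∸ i) * g (m ∸ (m ∸ i)))       ≡⟨ ∑-cong (suc m) (λ i i<1+m →
                                                           trans (cong (λ j → f (m ∸ i) * g j) (m∸[m∸n]≡n (s≤s⁻¹ i<1+m)))
                                                                 (*-comm (f (m ∸ i)) (g i))) ⟩
  ∑ (suc m) (λ i → g i * f (m ∸ i))                   ∎

⋆-∑ : ∀ f n (a : ℕ → ℕ) (g : ℕ → Series) m →
      (f ⋆ (λ t → ∑ n (λ k → a k * g k t))) m ≡ ∑ n (λ k → a k * (f ⋆ g k) m)
⋆-∑ f n a g m = begin
  ∑ (suc m) (λ i → f i * ∑ n (λ k → a k * g k (m ∸ i)))      ≡⟨ ∑-cong (suc m) (λ i _ → *-distribˡ-∑ n (f i) (λ k → a k * g k (m ∸ i))) ⟩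
  ∑ (suc m) (λ i → ∑ n (λ k → f i * (a k * g k (m ∸ i))))    ≡⟨ ∑-comm (suc m) n (λ i k → f i * (a k * g k (m ∸ i))) ⟩
  ∑ n (λ k → ∑ (suc m) (λ i → f i * (a k * g k (m ∸ i))))    ≡⟨ ∑-cong n (λ k _ → trans
                                                                 (∑-cong (suc m) (λ i _ → x∙yz≈y∙xz (f i) (a k) (g k (m ∸ i))))
                                                                 (sym (*-distribˡ-∑ (suc m) (a k) (λ i → f i * g k (m ∸ i))))) ⟩
  ∑ n (λ k → a k * (f ⋆ g k) m)                              ∎

-- h ≗ a /1-q^ c says h = a / (1 − q^c), i.e. h = a + q^c h.
infix 4 _≗_/1-q^_
_≗_/1-q^_ : Series → Series → ℕ → Set
h ≗ a /1-q^ c = ∀ m → h m ≡ a m + shift c h m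

/1-q^-cong : ∀ {a a′ c h} → (∀ m → a m ≡ a′ m) → h ≗ a /1-q^ c → h ≗ a′ /1-q^ c
/1-q^-cong {c = c} {h} a≗a′ h≗a/ m = trans (h≗a/ m) (cong (_+ shift c h m) (a≗a′ m))

/1-q^-⋆ : ∀ {a c h} → h ≗ a /1-q^ c → ∀ g → h ⋆ g ≗ a ⋆ g /1-q^ c
/1-q^-⋆ {a} {c} {h} h≗a/ g m = begin
  (h ⋆ g) m                                 ≡⟨ ⋆-congˡ g m h≗a/ ⟩
  ((λ i → a i + shift c h i) ⋆ g) m         ≡⟨ ⋆-distribʳ-+ a (shift c h) g m ⟩
  (a ⋆ g) m + (shift c h ⋆ g) m             ≡⟨ cong ((a ⋆ g) m +_) (shift-⋆ c h g m) ⟩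
  (a ⋆ g) m + shift c (h ⋆ g) m             ∎

/1-q^-at-0 : ∀ {a c h} → h ≗ a /1-q^ suc c → h 0 ≡ a 0
/1-q^-at-0 {a} h≗a/ = trans (h≗a/ 0) (+-identityʳ (a 0))

/1-q^-unique : ∀ {a c h₁ h₂} → h₁ ≗ a /1-q^ suc c → h₂ ≗ a /1-q^ suc c → ∀ m → h₁ m ≡ h₂ m
/1-q^-unique {a} {c} {h₁} {h₂} h₁≗ h₂≗ = <-rec (λ m → h₁ m ≡ h₂ m) step
  where
  step : ∀ m → (∀ {i} → i < m → h₁ i ≡ h₂ i) → h₁ m ≡ h₂ m
  step m ih with suc c ≤? m
  ... | yes c<m = trans (h₁≗ m) (trans (cong (a m +_) (trans (shift-≤ (suc c) h₁ c<m)
                    (trans (ih (∸-monoʳ-< z<s c<m)) (sym (shift-≤ (suc c) h₂ c<m))))) (sym (h₂≗ m)))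
  ... | no  c≮m = trans (h₁≗ m) (trans (cong (a m +_) (trans (shift-< (suc c) h₁ (≰⇒> c≮m))
                    (sym (shift-< (suc c) h₂ (≰⇒> c≮m))))) (sym (h₂≗ m)))

-- Generating functions of partitions

multiples : ℕ → Series
multiples c m = 𝟙 (c ∣? m)

multiples-/1-q^ : ∀ c → multiples (suc c) ≗ δ /1-q^ suc c
multiples-/1-q^ c zero = 𝟙-yes (suc c ∣? 0) (suc c ∣0)
multiples-/1-q^ c (suc m) with suc c ≤? suc m
... | yes c<1+m = trans (𝟙-cong (suc c ∣? suc m) (suc c ∣? suc m ∸ suc c)
                          (λ c∣1+m → ∣m+n∣m⇒∣n (subst (suc c ∣_) (sym (m+[n∸m]≡n c<1+m)) c∣1+m) (∣-refl {suc c}))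
                          (λ c∣rest → ∣m∸n∣n⇒∣m (suc c) c<1+m c∣rest (∣-refl {suc c})))
                        (sym (shift-≤ (suc c) (multiples (suc c)) c<1+m))
... | no  c≮1+m = trans (𝟙-no (suc c ∣? suc m) (c≮1+m ∘ ∣⇒≤))
                        (sym (shift-< (suc c) (multiples (suc c)) (≰⇒> c≮1+m)))

-- q^k / (1 − q^k)
positiveMultiples : ℕ → Series
positiveMultiples k = shift k (multiples k)

partsUpTo : ℕ → Series
partsUpTo zero    = δ
partsUpTo (suc b) = multiples (suc b) ⋆ partsUpTo b

parts≥3UpTo : ℕ → Series
parts≥3UpTo (suc (suc (suc b))) = multiples (3 + b) ⋆ parts≥3UpTo (suc (suc b))
parts≥3UpTo _                   = δ

partsUpTo-/1-q^ : ∀ b → partsUpTo (suc b) ≗ partsUpTo b /1-q^ suc b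
partsUpTo-/1-q^ b = /1-q^-cong {a = δ ⋆ partsUpTo b} {c = suc b} (⋆-identityˡ (partsUpTo b))
                                (/1-q^-⋆ {δ} {suc b} (multiples-/1-q^ b) (partsUpTo b))

parts≥3UpTo-/1-q^ : ∀ b → 3 ≤ suc b → parts≥3UpTo (suc b) ≗ parts≥3UpTo b /1-q^ suc b
parts≥3UpTo-/1-q^ zero          (s≤s ())
parts≥3UpTo-/1-q^ (suc zero)    (s≤s (s≤s ()))
parts≥3UpTo-/1-q^ (suc (suc b)) _ =
  /1-q^-cong {a = δ ⋆ parts≥3UpTo (2 + b)} {c = 3 + b} (⋆-identityˡ (parts≥3UpTo (2 + b)))
             (/1-q^-⋆ {δ} {3 + b} (multiples-/1-q^ (2 + b)) (parts≥3UpTo (2 + b)))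

parts≥3UpTo-suc : ∀ b m → parts≥3UpTo (suc b) m ≡
                  parts≥3UpTo b m + 𝟙 (3 ≤? suc b) * shift (suc b) (parts≥3UpTo (suc b)) m
parts≥3UpTo-suc zero          m = sym (+-identityʳ _)
parts≥3UpTo-suc (suc zero)    m = sym (+-identityʳ _)
parts≥3UpTo-suc (suc (suc b)) m = trans (parts≥3UpTo-/1-q^ (2 + b) (s≤s (s≤s (s≤s z≤n))) m)
                                        (cong (parts≥3UpTo (2 + b) m +_) (sym (+-identityʳ _)))

partsUpTo-at-0 : ∀ b → partsUpTo b 0 ≡ 1
partsUpTo-at-0 zero    = refl
partsUpTo-at-0 (suc b) = trans (/1-q^-at-0 (partsUpTo-/1-q^ b)) (partsUpTo-at-0 b)

parts≥3UpTo-at-0 : ∀ b → parts≥3UpTo b 0 ≡ 1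
parts≥3UpTo-at-0 (suc (suc (suc b))) =
  trans (/1-q^-at-0 (parts≥3UpTo-/1-q^ (2 + b) (s≤s (s≤s (s≤s z≤n))))) (parts≥3UpTo-at-0 (suc (suc b)))
parts≥3UpTo-at-0 zero          = refl
parts≥3UpTo-at-0 (suc zero)    = refl
parts≥3UpTo-at-0 (suc (suc zero)) = refl

partsUpTo-stable : ∀ d b {m} → m ≤ b → partsUpTo (d + b) m ≡ partsUpTo b m
partsUpTo-stable zero    b _   = refl
partsUpTo-stable (suc d) b {m} m≤b = begin
  partsUpTo (suc (d + b)) m                                      ≡⟨ partsUpTo-/1-q^ (d + b) m ⟩
  partsUpTo (d + b) m + shift (suc (d + b)) (partsUpTo (suc (d + b))) m
    ≡⟨ cong (partsUpTo (d + b) m +_) (shift-< (suc (d + b)) _ (s≤s (≤-trans m≤b (m≤n+m b d)))) ⟩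
  partsUpTo (d + b) m + 0                                        ≡⟨ +-identityʳ _ ⟩
  partsUpTo (d + b) m                                            ≡⟨ partsUpTo-stable d b m≤b ⟩
  partsUpTo b m                                                  ∎

partsUpTo-1 : ∀ m → partsUpTo 1 m ≡ 1
partsUpTo-1 zero    = refl
partsUpTo-1 (suc m) = trans (partsUpTo-/1-q^ 0 (suc m)) (partsUpTo-1 m)

2*partsUpTo-2 : ∀ s → 2 * partsUpTo 2 s + 𝟙 (2 ∣? 3 + s) ≡ 2 + s
2*partsUpTo-2 zero          = refl
2*partsUpTo-2 (suc zero)    = refl
2*partsUpTo-2 (suc (suc s)) = begin
  2 * partsUpTo 2 (2 + s) + 𝟙 (2 ∣? 2 + (3 + s))  ≡⟨ cong₂ (λ x y → 2 * x + y)
                                                      (trans (partsUpTo-/1-q^ 1 (2 + s)) (cong (_+ partsUpTo 2 s) (partsUpTo-1 (2 + s))))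
                                                      (𝟙-cong (2 ∣? 2 + (3 + s)) (2 ∣? 3 + s) 2∣2+n⇒2∣n (∣m∣n⇒∣m+n (∣-refl {2}))) ⟩
  2 * (1 + partsUpTo 2 s) + 𝟙 (2 ∣? 3 + s)        ≡⟨ cong (_+ 𝟙 (2 ∣? 3 + s)) (*-distribˡ-+ 2 1 (partsUpTo 2 s)) ⟩
  2 + 2 * partsUpTo 2 s + 𝟙 (2 ∣? 3 + s)          ≡⟨ +-assoc 2 (2 * partsUpTo 2 s) _ ⟩
  2 + (2 * partsUpTo 2 s + 𝟙 (2 ∣? 3 + s))        ≡⟨ cong (2 +_) (2*partsUpTo-2 s) ⟩
  2 + (2 + s)                                     ∎
  where
  2∣2+n⇒2∣n : ∀ {n} → 2 ∣ 2 + n → 2 ∣ n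
  2∣2+n⇒2∣n 2∣2+n = ∣m+n∣m⇒∣n 2∣2+n (∣-refl {2})

partsUpTo≡parts≥3UpTo⋆partsUpTo-2 : ∀ b m → partsUpTo (2 + b) m ≡ (parts≥3UpTo (2 + b) ⋆ partsUpTo 2) m
partsUpTo≡parts≥3UpTo⋆partsUpTo-2 zero    m = sym (⋆-identityˡ (partsUpTo 2) m)
partsUpTo≡parts≥3UpTo⋆partsUpTo-2 (suc b) m =
  /1-q^-unique (partsUpTo-/1-q^ (2 + b))
               (/1-q^-cong {a = parts≥3UpTo (2 + b) ⋆ partsUpTo 2} {c = 3 + b}
                           (λ i → sym (partsUpTo≡parts≥3UpTo⋆partsUpTo-2 b i))
                           (/1-q^-⋆ {parts≥3UpTo (2 + b)} {3 + b} (parts≥3UpTo-/1-q^ (2 + b) (s≤s (s≤s (s≤s z≤n)))) (partsUpTo 2)))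
               m

⋆-positiveMultiples : ∀ k (g : Series) m →
  (g ⋆ positiveMultiples (suc k)) m ≡ shift (suc k) (λ i → g i + (g ⋆ positiveMultiples (suc k)) i) m
⋆-positiveMultiples k g m = begin
  (g ⋆ positiveMultiples (suc k)) m                                ≡⟨ ⋆-comm g (positiveMultiples (suc k)) m ⟩
  (shift (suc k) (multiples (suc k)) ⋆ g) m                        ≡⟨ shift-⋆ (suc k) (multiples (suc k)) g m ⟩
  shift (suc k) (multiples (suc k) ⋆ g) m                          ≡⟨ shift-cong (suc k) unfold m ⟩
  shift (suc k) (λ i → g i + (g ⋆ positiveMultiples (suc k)) i) m  ∎
  where
  unfold : ∀ i → (multiples (suc k) ⋆ g) i ≡ g i + (g ⋆ positiveMultiples (suc k)) i
  unfold i = trans (/1-q^-⋆ {δ} {suc k} (multiples-/1-q^ k) g i)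
                   (cong₂ _+_ (⋆-identityˡ g i)
                              (trans (sym (shift-⋆ (suc k) (multiples (suc k)) g i)) (⋆-comm (positiveMultiples (suc k)) g i)))

-- [k ≤ b] q^k/(1 − q^k) ∏_{3 ≤ j ≤ b} 1/(1 − q^j)
multiplicitySeries : ℕ → ℕ → Series
multiplicitySeries k b m = 𝟙 (k ≤? b) * (parts≥3UpTo b ⋆ positiveMultiples k) m

-- The right-hand side has the shape produced by splitting partitions by their largest part b + 1.
multiplicitySeries-suc : ∀ k → 3 ≤ k → ∀ b m →
  multiplicitySeries k (suc b) m ≡
  multiplicitySeries k b m + 𝟙 (suc b ≤? m) * (𝟙 (3 ≤? suc b) *
    (𝟙 (suc b ≟ k) * parts≥3UpTo (suc b) (m ∸ suc b) + multiplicitySeries k (suc b) (m ∸ suc b)))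
multiplicitySeries-suc k 3≤k b m with <-cmp (suc b) k
... | tri< b<k _ _
  rewrite 𝟙-no (k ≤? suc b) (<⇒≱ b<k) | 𝟙-no (k ≤? b) (<⇒≱ b<k ∘ m≤n⇒m≤1+n) | 𝟙-no (suc b ≟ k) (<⇒≢ b<k)
  = sym (trans (cong (𝟙 (suc b ≤? m) *_) (*-zeroʳ (𝟙 (3 ≤? suc b)))) (*-zeroʳ (𝟙 (suc b ≤? m))))
multiplicitySeries-suc .(suc b) 3≤k b m | tri≈ _ refl _
  rewrite 𝟙-no (suc b ≤? b) (<⇒≱ ≤-refl) | 𝟙-yes (suc b ≤? suc b) ≤-refl
        | 𝟙-yes (suc b ≟ suc b) refl | 𝟙-yes (3 ≤? suc b) 3≤k
  = begin
    Σk m + 0                                                     ≡⟨ +-identityʳ _ ⟩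
    Σk m                                                         ≡⟨ ⋆-positiveMultiples b (parts≥3UpTo (suc b)) m ⟩
    shift (suc b) (λ i → parts≥3UpTo (suc b) i + Σk i) m         ≡⟨ shift≡𝟙* (suc b) _ m ⟩
    𝟙 (suc b ≤? m) * (parts≥3UpTo (suc b) (m ∸ suc b) + Σk (m ∸ suc b))
      ≡⟨ cong (𝟙 (suc b ≤? m) *_) (sym (trans (+-identityʳ _)
           (cong₂ _+_ (+-identityʳ (parts≥3UpTo (suc b) (m ∸ suc b))) (+-identityʳ (Σk (m ∸ suc b)))))) ⟩
    𝟙 (suc b ≤? m) * (1 * (1 * parts≥3UpTo (suc b) (m ∸ suc b) + (Σk (m ∸ suc b) + 0)))  ∎
  where
  Σk : Series
  Σk = parts≥3UpTo (suc b) ⋆ positiveMultiples (suc b)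
... | tri> _ _ k<b
  rewrite 𝟙-yes (k ≤? suc b) (<⇒≤ k<b) | 𝟙-yes (k ≤? b) (s≤s⁻¹ k<b)
        | 𝟙-no (suc b ≟ k) (<⇒≢ k<b ∘ sym) | 𝟙-yes (3 ≤? suc b) (≤-trans 3≤k (<⇒≤ k<b))
  = begin
    Σb+1 m + 0                                           ≡⟨ +-identityʳ _ ⟩
    Σb+1 m                                               ≡⟨ /1-q^-⋆ {parts≥3UpTo b} {suc b} (parts≥3UpTo-/1-q^ b (≤-trans 3≤k (<⇒≤ k<b))) (positiveMultiples k) m ⟩
    Σb m + shift (suc b) Σb+1 m                          ≡⟨ cong₂ _+_ (sym (+-identityʳ _)) (shift≡𝟙* (suc b) Σb+1 m) ⟩
    (Σb m + 0) + 𝟙 (suc b ≤? m) * Σb+1 (m ∸ suc b)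
      ≡⟨ cong (λ x → (Σb m + 0) + 𝟙 (suc b ≤? m) * x) (sym (trans (+-identityʳ _) (+-identityʳ _))) ⟩
    (Σb m + 0) + 𝟙 (suc b ≤? m) * (1 * (0 * parts≥3UpTo (suc b) (m ∸ suc b) + (Σb+1 (m ∸ suc b) + 0))) ∎
  where
  Σb Σb+1 : Series
  Σb   = parts≥3UpTo b ⋆ positiveMultiples k
  Σb+1 = parts≥3UpTo (suc b) ⋆ positiveMultiples k

-- Counting partitions

record AdditiveWeight : Set where
  field
    W    : List (List ℕ) → ℕ
    W-[] : W [] ≡ 0
    W-++ : ∀ xs ys → W (xs ++ ys) ≡ W xs + W ys

module _ (A : AdditiveWeight) where
  open AdditiveWeight A

  W-concatMap : ∀ (G : ℕ → List (List ℕ)) m b (g : ℕ → ℕ) →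
                W (concatMap G (filter (_≤? m) (applyUpTo g b))) ≡ ∑ b (λ j → 𝟙 (g j ≤? m) * W (G (g j)))
  W-concatMap G m zero    g = W-[]
  W-concatMap G m (suc b) g with g 0 ≤? m
  ... | yes g0≤m = begin
    W (concatMap G (filter (_≤? m) (applyUpTo g (suc b))))
      ≡⟨ cong (W ∘ concatMap G) (filter-accept (_≤? m) g0≤m) ⟩
    W (G (g 0) ++ concatMap G (filter (_≤? m) (applyUpTo (g ∘ suc) b)))
      ≡⟨ W-++ (G (g 0)) _ ⟩
    W (G (g 0)) + W (concatMap G (filter (_≤? m) (applyUpTo (g ∘ suc) b)))
      ≡⟨ cong₂ _+_ (sym (trans (cong (_* W (G (g 0))) (𝟙-yes (g 0 ≤? m) g0≤m)) (+-identityʳ _)))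
                   (W-concatMap G m b (g ∘ suc)) ⟩
    𝟙 (g 0 ≤? m) * W (G (g 0)) + ∑ b (λ j → 𝟙 (g (suc j) ≤? m) * W (G (g (suc j))))  ∎
  ... | no  g0≰m = begin
    W (concatMap G (filter (_≤? m) (applyUpTo g (suc b))))
      ≡⟨ cong (W ∘ concatMap G) (filter-reject (_≤? m) g0≰m) ⟩
    W (concatMap G (filter (_≤? m) (applyUpTo (g ∘ suc) b)))
      ≡⟨ W-concatMap G m b (g ∘ suc) ⟩
    ∑ b (λ j → 𝟙 (g (suc j) ≤? m) * W (G (g (suc j))))
      ≡⟨ cong (_+ ∑ b (λ j → 𝟙 (g (suc j) ≤? m) * W (G (g (suc j))))) (sym (cong (_* W (G (g 0))) (𝟙-no (g 0 ≤? m) g0≰m))) ⟩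
    𝟙 (g 0 ≤? m) * W (G (g 0)) + ∑ b (λ j → 𝟙 (g (suc j) ≤? m) * W (G (g (suc j))))  ∎

  W-partsBounded-suc : ∀ f m b → W (partsBounded (suc f) (suc m) b) ≡
                       ∑ b (λ j → 𝟙 (suc j ≤? suc m) * W (map (suc j ∷_) (partsBounded f (m ∸ j) (suc j))))
  W-partsBounded-suc f m b = W-concatMap (λ k → map (k ∷_) (partsBounded f (suc m ∸ k) k)) (suc m) b suc

lengthWeight : AdditiveWeight
lengthWeight = record { W = length ; W-[] = refl ; W-++ = λ xs ys → length-++ xs }

allParts≥3 : List (List ℕ) → List (List ℕ)
allParts≥3 = filter (λ λs → T? (minAtLeast 3 λs))

#parts≥3 : List (List ℕ) → ℕ
#parts≥3 = length ∘ allParts≥3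

#parts≥3Weight : AdditiveWeight
#parts≥3Weight = record
  { W    = #parts≥3
  ; W-[] = refl
  ; W-++ = λ xs ys → trans (cong length (filter-++ _ xs ys)) (length-++ (allParts≥3 xs))
  }

multiplicity : ℕ → List (List ℕ) → ℕ
multiplicity k = sum ∘ map (count k) ∘ allParts≥3

multiplicityWeight : ℕ → AdditiveWeight
multiplicityWeight k = record
  { W    = multiplicity k
  ; W-[] = refl
  ; W-++ = λ xs ys → trans (cong (sum ∘ map (count k)) (filter-++ _ xs ys))
                           (trans (cong sum (map-++ (count k) (allParts≥3 xs) _)) (sum-++ (map (count k) (allParts≥3 xs)) _))
  }

allParts≥3-map-∷-<3 : ∀ {k} → k < 3 → ∀ L → allParts≥3 (map (k ∷_) L) ≡ []
allParts≥3-map-∷-<3 _ [] = refl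
allParts≥3-map-∷-<3 {0} k<3 (_ ∷ L) = allParts≥3-map-∷-<3 k<3 L
allParts≥3-map-∷-<3 {1} k<3 (_ ∷ L) = allParts≥3-map-∷-<3 k<3 L
allParts≥3-map-∷-<3 {2} k<3 (_ ∷ L) = allParts≥3-map-∷-<3 k<3 L
allParts≥3-map-∷-<3 {suc (suc (suc _))} (s<s (s<s (s<s ()))) (_ ∷ _)

allParts≥3-map-∷ : ∀ k L → allParts≥3 (map (3 + k ∷_) L) ≡ map (3 + k ∷_) (allParts≥3 L)
allParts≥3-map-∷ k [] = refl
allParts≥3-map-∷ k (l ∷ L) with minAtLeast 3 l
... | true  = cong ((3 + k ∷ l) ∷_) (allParts≥3-map-∷ k L)
... | false = allParts≥3-map-∷ k L

#parts≥3-map-∷ : ∀ j L → #parts≥3 (map (suc j ∷_) L) ≡ 𝟙 (3 ≤? suc j) * #parts≥3 L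
#parts≥3-map-∷ zero          L = cong length (allParts≥3-map-∷-<3 (s<s z<s) L)
#parts≥3-map-∷ (suc zero)    L = cong length (allParts≥3-map-∷-<3 (s<s (s<s z<s)) L)
#parts≥3-map-∷ (suc (suc j)) L =
  trans (cong length (allParts≥3-map-∷ j L)) (trans (length-map (3 + j ∷_) (allParts≥3 L)) (sym (+-identityʳ _)))

sum-count-map-∷ : ∀ j k L → sum (map (count k) (map (j ∷_) L)) ≡ 𝟙 (j ≟ k) * length L + sum (map (count k) L)
sum-count-map-∷ j k []      = sym (cong (_+ 0) (*-zeroʳ (𝟙 (j ≟ k))))
sum-count-map-∷ j k (l ∷ L) = begin
  (𝟙 (j ≟ k) + count k l) + sum (map (count k) (map (j ∷_) L))
    ≡⟨ cong ((𝟙 (j ≟ k) + count k l) +_) (sum-count-map-∷ j k L) ⟩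
  (𝟙 (j ≟ k) + count k l) + (𝟙 (j ≟ k) * length L + sum (map (count k) L))
    ≡⟨ interchange (𝟙 (j ≟ k)) (count k l) _ _ ⟩
  (𝟙 (j ≟ k) + 𝟙 (j ≟ k) * length L) + (count k l + sum (map (count k) L))
    ≡⟨ cong (_+ (count k l + sum (map (count k) L))) (sym (*-suc (𝟙 (j ≟ k)) (length L))) ⟩
  𝟙 (j ≟ k) * suc (length L) + (count k l + sum (map (count k) L))  ∎

multiplicity-map-∷ : ∀ j k L →
  multiplicity k (map (suc j ∷_) L) ≡ 𝟙 (3 ≤? suc j) * (𝟙 (suc j ≟ k) * #parts≥3 L + multiplicity k L)
multiplicity-map-∷ zero          k L = cong (sum ∘ map (count k)) (allParts≥3-map-∷-<3 (s<s z<s) L)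
multiplicity-map-∷ (suc zero)    k L = cong (sum ∘ map (count k)) (allParts≥3-map-∷-<3 (s<s (s<s z<s)) L)
multiplicity-map-∷ (suc (suc j)) k L =
  trans (cong (sum ∘ map (count k)) (allParts≥3-map-∷ j L))
        (trans (sum-count-map-∷ (3 + j) k (allParts≥3 L)) (sym (+-identityʳ _)))

length-partsBounded : ∀ f m b → m ≤ f → length (partsBounded f m b) ≡ partsUpTo b m
length-partsBounded f       zero    b _         = sym (partsUpTo-at-0 b)
length-partsBounded (suc f) (suc m) b (s≤s m≤f) = begin
  length (partsBounded (suc f) (suc m) b)
    ≡⟨ W-partsBounded-suc lengthWeight f m b ⟩
  ∑ b (λ j → 𝟙 (suc j ≤? suc m) * length (map (suc j ∷_) (partsBounded f (m ∸ j) (suc j))))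
    ≡⟨ ∑-cong b (λ j _ → cong (𝟙 (suc j ≤? suc m) *_) (trans (length-map (suc j ∷_) (partsBounded f (m ∸ j) (suc j)))
                                                            (length-partsBounded f (m ∸ j) (suc j) (≤-trans (m∸n≤m m j) m≤f)))) ⟩
  ∑ b (λ j → 𝟙 (suc j ≤? suc m) * partsUpTo (suc j) (m ∸ j))
    ≡⟨ ∑-telescope (λ b → partsUpTo b (suc m)) _ refl
         (λ b → trans (partsUpTo-/1-q^ b (suc m)) (cong (partsUpTo b (suc m) +_) (shift≡𝟙* (suc b) (partsUpTo (suc b)) (suc m)))) b ⟩
  partsUpTo b (suc m)  ∎

#parts≥3-partsBounded : ∀ f m b → m ≤ f → #parts≥3 (partsBounded f m b) ≡ parts≥3UpTo b m
#parts≥3-partsBounded f       zero    b _         = sym (parts≥3UpTo-at-0 b)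
#parts≥3-partsBounded (suc f) (suc m) b (s≤s m≤f) = begin
  #parts≥3 (partsBounded (suc f) (suc m) b)
    ≡⟨ W-partsBounded-suc #parts≥3Weight f m b ⟩
  ∑ b (λ j → 𝟙 (suc j ≤? suc m) * #parts≥3 (map (suc j ∷_) (partsBounded f (m ∸ j) (suc j))))
    ≡⟨ ∑-cong b (λ j _ → cong (𝟙 (suc j ≤? suc m) *_) (trans (#parts≥3-map-∷ j (partsBounded f (m ∸ j) (suc j)))
         (cong (𝟙 (3 ≤? suc j) *_) (#parts≥3-partsBounded f (m ∸ j) (suc j) (≤-trans (m∸n≤m m j) m≤f))))) ⟩
  ∑ b (λ j → 𝟙 (suc j ≤? suc m) * (𝟙 (3 ≤? suc j) * parts≥3UpTo (suc j) (m ∸ j)))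
    ≡⟨ ∑-telescope (λ b → parts≥3UpTo b (suc m)) _ refl step b ⟩
  parts≥3UpTo b (suc m)  ∎
  where
  step : ∀ b → parts≥3UpTo (suc b) (suc m) ≡
               parts≥3UpTo b (suc m) + 𝟙 (suc b ≤? suc m) * (𝟙 (3 ≤? suc b) * parts≥3UpTo (suc b) (m ∸ b))
  step b = trans (parts≥3UpTo-suc b (suc m)) (cong (parts≥3UpTo b (suc m) +_)
             (trans (cong (𝟙 (3 ≤? suc b) *_) (shift≡𝟙* (suc b) (parts≥3UpTo (suc b)) (suc m)))
                    (x∙yz≈y∙xz (𝟙 (3 ≤? suc b)) (𝟙 (suc b ≤? suc m)) _)))

multiplicity-partsBounded : ∀ k → 3 ≤ k → ∀ f m b → m ≤ f → multiplicity k (partsBounded f m b) ≡ multiplicitySeries k b m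
multiplicity-partsBounded k 3≤k f zero b _ =
  sym (trans (cong (𝟙 (k ≤? b) *_) (trans (+-identityʳ _)
                (trans (cong (parts≥3UpTo b 0 *_) (shift-< k (multiples k) (≤-trans z<s 3≤k))) (*-zeroʳ (parts≥3UpTo b 0)))))
             (*-zeroʳ (𝟙 (k ≤? b))))
multiplicity-partsBounded k 3≤k (suc f) (suc m) b (s≤s m≤f) = begin
  multiplicity k (partsBounded (suc f) (suc m) b)
    ≡⟨ W-partsBounded-suc (multiplicityWeight k) f m b ⟩
  ∑ b (λ j → 𝟙 (suc j ≤? suc m) * multiplicity k (map (suc j ∷_) (partsBounded f (m ∸ j) (suc j))))
    ≡⟨ ∑-cong b (λ j _ → cong (𝟙 (suc j ≤? suc m) *_) (trans (multiplicity-map-∷ j k (partsBounded f (m ∸ j) (suc j)))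
         (cong (𝟙 (3 ≤? suc j) *_) (cong₂ (λ x y → 𝟙 (suc j ≟ k) * x + y)
            (#parts≥3-partsBounded f (m ∸ j) (suc j) (≤-trans (m∸n≤m m j) m≤f))
            (multiplicity-partsBounded k 3≤k f (m ∸ j) (suc j) (≤-trans (m∸n≤m m j) m≤f)))))) ⟩
  ∑ b (λ j → 𝟙 (suc j ≤? suc m) * (𝟙 (3 ≤? suc j) *
               (𝟙 (suc j ≟ k) * parts≥3UpTo (suc j) (m ∸ j) + multiplicitySeries k (suc j) (m ∸ j))))
    ≡⟨ ∑-telescope (λ b → multiplicitySeries k b (suc m)) _
         (cong (_* (parts≥3UpTo 0 ⋆ positiveMultiples k) (suc m)) (𝟙-no (k ≤? 0) (<⇒≱ (≤-trans z<s 3≤k))))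
         (λ b → multiplicitySeries-suc k 3≤k b (suc m)) b ⟩
  multiplicitySeries k b (suc m)  ∎

-- Euler's totient

coprimeTo : ℕ → ℕ → ℕ
coprimeTo k j = 𝟙 (gcd j k ≟ 1)

φ-as-∑ : ∀ k → φ k ≡ ∑ k (coprimeTo k ∘ suc)
φ-as-∑ k = length-filter-applyUpTo (λ i → gcd i k ≟ 1) suc k

φ-as-∑₀ : ∀ k → 2 ≤ k → φ k ≡ ∑ (suc k) (coprimeTo k)
φ-as-∑₀ k 2≤k = trans (φ-as-∑ k) (cong (_+ ∑ k (coprimeTo k ∘ suc)) (sym coprimeTo-0))
  where
  coprimeTo-0 : coprimeTo k 0 ≡ 0
  coprimeTo-0 = 𝟙-no (gcd 0 k ≟ 1) (λ gcd≡1 → <⇒≱ 2≤k (≤-reflexive (trans (sym (gcd-identityˡ k)) gcd≡1)))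

coprimeTo-reflect : ∀ k j → j ≤ k → coprimeTo k (k ∸ j) ≡ coprimeTo k j
coprimeTo-reflect k j j≤k = cong (λ d → 𝟙 (d ≟ 1)) (∣-antisym
  (gcd-greatest (∣m+n∣m⇒∣n (subst (gcd (k ∸ j) k ∣_) (sym (m∸n+n≡m j≤k)) (gcd[m,n]∣n (k ∸ j) k)) (gcd[m,n]∣m (k ∸ j) k))
                (gcd[m,n]∣n (k ∸ j) k))
  (gcd-greatest (∣m+n∣m⇒∣n (subst (gcd j k ∣_) (sym (m+[n∸m]≡n j≤k)) (gcd[m,n]∣n j k)) (gcd[m,n]∣m j k))
                (gcd[m,n]∣n j k)))

even⊎odd : ∀ n → ∃[ c ] (n ≡ c + c ⊎ n ≡ suc (c + c))
even⊎odd zero = 0 , inj₁ refl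
even⊎odd (suc n) with even⊎odd n
... | c , inj₁ n≡c+c   = c , inj₂ (cong suc n≡c+c)
... | c , inj₂ n≡1+c+c = suc c , inj₁ (trans (cong suc n≡1+c+c) (sym (+-suc (suc c) c)))

-- j ↦ k − j pairs off the residues coprime to k, fixing only k/2, which is not coprime to k ≥ 3.
2∣φ : ∀ k → 3 ≤ k → 2 ∣ φ k
2∣φ k 3≤k with even⊎odd k
... | c , inj₁ refl = divides (∑ c (coprimeTo k)) (trans (φ-as-∑₀ k (≤-trans (n≤1+n 2) 3≤k)) (trans
        (∑[1+n+n]-palindrome c (coprimeTo k) coprimeTo-half
          (λ j j<c → coprimeTo-reflect k j (≤-trans (<⇒≤ j<c) (m≤m+n c c))))
        (*-comm 2 (∑ c (coprimeTo k)))))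
  where
  coprimeTo-half : coprimeTo (c + c) c ≡ 0
  coprimeTo-half = 𝟙-no (gcd c (c + c) ≟ 1) (λ gcd≡1 → <⇒≱ 3≤k (≤-reflexive (cong (λ d → d + d)
    (trans (sym (∣-antisym (gcd[m,n]∣m c (c + c)) (gcd-greatest ∣-refl (∣m∣n⇒∣m+n ∣-refl ∣-refl)))) gcd≡1))))
... | c , inj₂ refl = divides (∑ (suc c) (coprimeTo k)) (trans (φ-as-∑₀ k (≤-trans (n≤1+n 2) 3≤k)) (trans
        (cong (λ n → ∑ (suc n) (coprimeTo k)) (sym (+-suc c c)))
        (trans (∑[n+n]-palindrome (suc c) (coprimeTo k)
                 (λ j j<1+c → trans (cong (λ n → coprimeTo k (n ∸ j)) (+-suc c c))
                                    (coprimeTo-reflect k j (≤-trans (<⇒≤ j<1+c) (s≤s (m≤m+n c c))))))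
               (*-comm 2 (∑ (suc c) (coprimeTo k))))))

∑-gcd≡-block : ∀ g′ d q →
  ∑ (suc g′) (λ r → 𝟙 (gcd (suc (q * suc g′ + r)) (suc g′ * d) ≟ suc g′)) ≡ coprimeTo d (suc q)
∑-gcd≡-block g′ d q = trans (∑-suc g′ _) (cong₂ _+_ below-last last)
  where
  g : ℕ
  g = suc g′
  below-last : ∑ g′ (λ r → 𝟙 (gcd (suc (q * g + r)) (g * d) ≟ g)) ≡ 0
  below-last = ∑-zero g′ (λ r r<g′ → 𝟙-no (gcd (suc (q * g + r)) (g * d) ≟ g) (λ gcd≡g →
    let g∣qg+1+r : g ∣ q * g + suc r
        g∣qg+1+r = subst (_∣ q * g + suc r) gcd≡g
                     (subst (gcd (suc (q * g + r)) (g * d) ∣_) (sym (+-suc (q * g) r)) (gcd[m,n]∣m (suc (q * g + r)) (g * d)))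
    in <⇒≱ (s<s r<g′) (∣⇒≤ (∣m+n∣m⇒∣n g∣qg+1+r (n∣m*n q)))))
  qg+g′+1≡g*[q+1] : suc (q * g + g′) ≡ g * suc q
  qg+g′+1≡g*[q+1] = trans (sym (+-suc (q * g) g′)) (trans (+-comm (q * g) g) (*-comm (suc q) g))
  last : 𝟙 (gcd (suc (q * g + g′)) (g * d) ≟ g) ≡ coprimeTo d (suc q)
  last = trans (cong (λ n → 𝟙 (gcd n (g * d) ≟ g)) qg+g′+1≡g*[q+1])
    (trans (cong (λ n → 𝟙 (n ≟ g)) (sym (c*gcd[m,n]≡gcd[cm,cn] g (suc q) d)))
      (𝟙-cong (g * gcd (suc q) d ≟ g) (gcd (suc q) d ≟ 1)
        (λ g*gcd≡g → *-cancelˡ-≡ (gcd (suc q) d) 1 g (trans g*gcd≡g (sym (*-identityʳ g))))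
        (λ gcd≡1 → trans (cong (g *_) gcd≡1) (*-identityʳ g))))

-- The residues i ≤ gd with gcd(i, gd) = g are the multiples g i′ with gcd(i′, d) = 1.
∑-gcd≡ : ∀ g′ d′ → ∑ (suc d′ * suc g′) (λ i → 𝟙 (gcd (suc i) (suc g′ * suc d′) ≟ suc g′)) ≡ φ (suc d′)
∑-gcd≡ g′ d′ = begin
  ∑ (d * g) (λ i → 𝟙 (gcd (suc i) (g * d) ≟ g))                 ≡⟨ ∑-* d g (λ i → 𝟙 (gcd (suc i) (g * d) ≟ g)) ⟩
  ∑ d (λ q → ∑ g (λ r → 𝟙 (gcd (suc (q * g + r)) (g * d) ≟ g))) ≡⟨ ∑-cong d (λ q _ → ∑-gcd≡-block g′ d q) ⟩
  ∑ d (coprimeTo d ∘ suc)                                       ≡⟨ sym (φ-as-∑ d) ⟩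
  φ d                                                           ∎
  where
  g d : ℕ
  g = suc g′
  d = suc d′

∑-gcd*≡ : ∀ t d′ → ∑ (suc t) (λ i → 𝟙 (gcd (suc i) (suc t) * suc d′ ≟ suc t)) ≡ 𝟙 (suc d′ ∣? suc t) * φ (suc d′)
∑-gcd*≡ t d′ with suc d′ ∣? suc t
... | no d∤t = trans (∑-zero (suc t) (λ i _ → 𝟙-no (gcd (suc i) (suc t) * suc d′ ≟ suc t)
                       (λ gcd*d≡t → d∤t (divides (gcd (suc i) (suc t)) (sym gcd*d≡t)))))
                     (sym (cong (_* φ (suc d′)) (𝟙-no (suc d′ ∣? suc t) d∤t)))
... | yes d∣t@(divides (suc g′) t≡g*d) =
  trans (via-cofactor t≡g*d) (sym (trans (cong (_* φ d) (𝟙-yes (d ∣? suc t) d∣t)) (+-identityʳ (φ d))))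
  where
  g d : ℕ
  g = suc g′
  d = suc d′
  via-cofactor : ∀ {n} → n ≡ g * d → ∑ n (λ i → 𝟙 (gcd (suc i) n * d ≟ n)) ≡ φ d
  via-cofactor refl = begin
    ∑ (g * d) (λ i → 𝟙 (gcd (suc i) (g * d) * d ≟ g * d))
      ≡⟨ cong (λ n → ∑ n (λ i → 𝟙 (gcd (suc i) (g * d) * d ≟ g * d))) (*-comm g d) ⟩
    ∑ (d * g) (λ i → 𝟙 (gcd (suc i) (g * d) * d ≟ g * d))
      ≡⟨ ∑-cong (d * g) (λ i _ → 𝟙-cong (gcd (suc i) (g * d) * d ≟ g * d) (gcd (suc i) (g * d) ≟ g)
                                        (*-cancelʳ-≡ (gcd (suc i) (g * d)) g d) (cong (_* d))) ⟩
    ∑ (d * g) (λ i → 𝟙 (gcd (suc i) (g * d) ≟ g))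
      ≡⟨ ∑-gcd≡ g′ d′ ⟩
    φ d  ∎

-- ∑_{d ∣ t} f d, for t ≥ 1
divisorSum : (ℕ → ℕ) → ℕ → ℕ
divisorSum f t = ∑ t (λ k → 𝟙 (suc k ∣? t) * f (suc k))

divisorSum-extend : ∀ f t n → suc t ≤ n → ∑ n (λ k → 𝟙 (suc k ∣? suc t) * f (suc k)) ≡ divisorSum f (suc t)
divisorSum-extend f t n t<n = begin
  ∑ n F                                          ≡⟨ cong (λ m → ∑ m F) (sym (m+[n∸m]≡n t<n)) ⟩
  ∑ (suc t + (n ∸ suc t)) F                      ≡⟨ ∑-+ (suc t) (n ∸ suc t) F ⟩
  ∑ (suc t) F + ∑ (n ∸ suc t) (F ∘ (suc t +_))   ≡⟨ cong (∑ (suc t) F +_) (∑-zero (n ∸ suc t) (λ i _ →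
                                                      cong (_* f (suc (suc t + i))) (𝟙-no (suc (suc t + i) ∣? suc t)
                                                        (<⇒≱ (s<s (m≤m+n (suc t) i)) ∘ ∣⇒≤)))) ⟩
  ∑ (suc t) F + 0                                ≡⟨ +-identityʳ _ ⟩
  divisorSum f (suc t)                           ∎
  where
  F : ℕ → ℕ
  F k = 𝟙 (suc k ∣? suc t) * f (suc k)

-- Gauss: every i ≤ t has gcd(i, t) · k = t for exactly one k ∣ t.
divisorSum-φ : ∀ t → divisorSum φ (suc t) ≡ suc t
divisorSum-φ t = begin
  divisorSum φ (suc t)                                         ≡⟨ ∑-cong (suc t) (λ k _ → sym (∑-gcd*≡ t k)) ⟩
  ∑ (suc t) (λ k → ∑ (suc t) (λ i → gcd[i+1]*[k+1]≡t i k))     ≡⟨ ∑-comm (suc t) (suc t) (λ k i → gcd[i+1]*[k+1]≡t i k) ⟩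
  ∑ (suc t) (λ i → ∑ (suc t) (gcd[i+1]*[k+1]≡t i))             ≡⟨ ∑-cong (suc t) (λ i _ → unique-cofactor i) ⟩
  ∑ (suc t) (λ _ → 1)                                          ≡⟨ ∑-const-1 (suc t) ⟩
  suc t                                                        ∎
  where
  gcd[i+1]*[k+1]≡t : ℕ → ℕ → ℕ
  gcd[i+1]*[k+1]≡t i k = 𝟙 (gcd (suc i) (suc t) * suc k ≟ suc t)
  unique-cofactor : ∀ i → ∑ (suc t) (gcd[i+1]*[k+1]≡t i) ≡ 1
  unique-cofactor i with gcd[m,n]∣n (suc i) (suc t)
  ... | divides zero t≡0 = ⊥-elim (1+n≢0 t≡0)
  ... | divides (suc q) t≡[q+1]*gcd = trans
          (∑-cong (suc t) (λ k _ → 𝟙-cong (gcd (suc i) (suc t) * suc k ≟ suc t) (k ≟ q)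
            (λ gcd*[k+1]≡t → suc-injective (*-cancelʳ-≡ (suc k) (suc q) gcd′ ⦃ gcd≢0 ⦄
                                (trans (*-comm (suc k) gcd′) (trans gcd*[k+1]≡t t≡[q+1]*gcd))))
            (λ k≡q → trans (*-comm gcd′ (suc k)) (trans (cong (λ n → suc n * gcd′) k≡q) (sym t≡[q+1]*gcd)))))
          (∑-𝟙-≡ (suc t) q (≤-trans (m≤m*n (suc q) gcd′ ⦃ gcd≢0 ⦄) (≤-reflexive (sym t≡[q+1]*gcd))))
    where
    gcd′ : ℕ
    gcd′ = gcd (suc i) (suc t)
    gcd≢0 : NonZero gcd′
    gcd≢0 = ≢-nonZero (gcd[m,n]≢0 (suc i) (suc t) (inj₁ (λ ())))

-- Lambert series

2*Pφ+𝟙[≤2]≡φ : ∀ k → 2 * Pφ (suc k) + 𝟙 (suc k ≤? 2) ≡ φ (suc k)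
2*Pφ+𝟙[≤2]≡φ zero          = refl
2*Pφ+𝟙[≤2]≡φ (suc zero)    = refl
2*Pφ+𝟙[≤2]≡φ (suc (suc k)) = trans (+-identityʳ _) (m*[n/m]≡n (2∣φ (3 + k) (s≤s (s≤s (s≤s z≤n)))))

divisorSum-𝟙[≤2] : ∀ t → divisorSum (λ k → 𝟙 (k ≤? 2)) (suc t) ≡ 1 + 𝟙 (2 ∣? suc t)
divisorSum-𝟙[≤2] zero    = refl
divisorSum-𝟙[≤2] (suc s) = trans
  (cong₂ (λ x y → x * 1 + (𝟙 (2 ∣? 2 + s) * 1 + y)) (𝟙-yes (1 ∣? 2 + s) (1∣ (2 + s)))
                                                   (∑-zero s (λ k _ → *-zeroʳ (𝟙 (3 + k ∣? 2 + s)))))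
  (cong suc (trans (+-identityʳ _) (*-identityʳ _)))

2*divisorSum-Pφ : ∀ t → 2 * divisorSum Pφ (suc t) + (1 + 𝟙 (2 ∣? suc t)) ≡ suc t
2*divisorSum-Pφ t = begin
  2 * ∑ (suc t) (λ k → d k * Pφ (suc k)) + (1 + 𝟙 (2 ∣? suc t))
    ≡⟨ cong₂ _+_ (*-distribˡ-∑ (suc t) 2 (λ k → d k * Pφ (suc k))) (sym (divisorSum-𝟙[≤2] t)) ⟩
  ∑ (suc t) (λ k → 2 * (d k * Pφ (suc k))) + ∑ (suc t) (λ k → d k * 𝟙 (suc k ≤? 2))
    ≡⟨ sym (∑-distrib-+ (suc t) (λ k → 2 * (d k * Pφ (suc k))) (λ k → d k * 𝟙 (suc k ≤? 2))) ⟩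
  ∑ (suc t) (λ k → 2 * (d k * Pφ (suc k)) + d k * 𝟙 (suc k ≤? 2))
    ≡⟨ ∑-cong (suc t) (λ k _ → begin
         2 * (d k * Pφ (suc k)) + d k * 𝟙 (suc k ≤? 2)   ≡⟨ cong (_+ d k * 𝟙 (suc k ≤? 2)) (x∙yz≈y∙xz 2 (d k) (Pφ (suc k))) ⟩
         d k * (2 * Pφ (suc k)) + d k * 𝟙 (suc k ≤? 2)   ≡⟨ sym (*-distribˡ-+ (d k) (2 * Pφ (suc k)) _) ⟩
         d k * (2 * Pφ (suc k) + 𝟙 (suc k ≤? 2))         ≡⟨ cong (d k *_) (2*Pφ+𝟙[≤2]≡φ k) ⟩
         d k * φ (suc k)                                 ∎) ⟩
  divisorSum φ (suc t)
    ≡⟨ divisorSum-φ t ⟩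
  suc t  ∎
  where
  d : ℕ → ℕ
  d k = 𝟙 (suc k ∣? suc t)

2*shift-3[partsUpTo-2] : ∀ t → 2 * shift 3 (partsUpTo 2) (suc t) + (1 + 𝟙 (2 ∣? suc t)) ≡ suc t
2*shift-3[partsUpTo-2] zero          = refl
2*shift-3[partsUpTo-2] (suc zero)    = refl
2*shift-3[partsUpTo-2] (suc (suc s)) = trans (+-suc (2 * partsUpTo 2 s) _) (cong suc (2*partsUpTo-2 s))

divisorSum-Pφ : ∀ t → divisorSum Pφ (suc t) ≡ shift 3 (partsUpTo 2) (suc t)
divisorSum-Pφ t = *-cancelˡ-≡ _ _ 2 (+-cancelʳ-≡ (1 + 𝟙 (2 ∣? suc t)) _ _
                    (trans (2*divisorSum-Pφ t) (sym (2*shift-3[partsUpTo-2] t))))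

∑-Pφ*positiveMultiples : ∀ n t → t ≤ 3 + n →
  ∑ (suc n) (λ i → Pφ (3 + i) * positiveMultiples (3 + i) t) ≡ shift 3 (partsUpTo 2) t
∑-Pφ*positiveMultiples n zero    _   = ∑-zero (suc n) (λ i _ → *-zeroʳ (Pφ (3 + i)))
∑-Pφ*positiveMultiples n (suc t) t<3+n = begin
  ∑ (suc n) (λ i → Pφ (3 + i) * positiveMultiples (3 + i) (suc t))
    ≡⟨ ∑-cong (suc n) (λ i _ → trans (cong (Pφ (3 + i) *_) (sym (multiples-/1-q^ (2 + i) (suc t))))
                                     (*-comm (Pφ (3 + i)) _)) ⟩
  ∑ (suc n) (F ∘ (2 +_))
    ≡⟨ sym (cong₂ _+_ (*-zeroʳ (𝟙 (1 ∣? suc t))) (cong₂ _+_ (*-zeroʳ (𝟙 (2 ∣? suc t))) refl)) ⟩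
  ∑ (3 + n) F
    ≡⟨ divisorSum-extend Pφ t (3 + n) t<3+n ⟩
  divisorSum Pφ (suc t)
    ≡⟨ divisorSum-Pφ t ⟩
  shift 3 (partsUpTo 2) (suc t)  ∎
  where
  F : ℕ → ℕ
  F k = 𝟙 (suc k ∣? suc t) * Pφ (suc k)

S≡coefficient : ∀ n i → i ≤ n → S 3 (3 + n) (3 + i) ≡ (parts≥3UpTo (3 + n) ⋆ positiveMultiples (3 + i)) (3 + n)
S≡coefficient n i i≤n =
  trans (multiplicity-partsBounded (3 + i) (s≤s (s≤s (s≤s z≤n))) (3 + n) (3 + n) (3 + n) ≤-refl)
        (trans (cong (_* (parts≥3UpTo (3 + n) ⋆ positiveMultiples (3 + i)) (3 + n))
                     (𝟙-yes (3 + i ≤? 3 + n) (s≤s (s≤s (s≤s i≤n)))))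
               (+-identityʳ _))

theorem3 : (n : ℕ) → p n ≡ sumFromTo 3 (n + 3) (λ k → Pφ k * S 3 (n + 3) k)
theorem3 n = begin
  p n                                                        ≡⟨ length-partsBounded n n n ≤-refl ⟩
  partsUpTo n n                                              ≡⟨ sym (partsUpTo-stable 3 n ≤-refl) ⟩
  partsUpTo (3 + n) n                                        ≡⟨ partsUpTo≡parts≥3UpTo⋆partsUpTo-2 (suc n) n ⟩
  (Q ⋆ partsUpTo 2) n                                        ≡⟨ ⋆-comm Q (partsUpTo 2) n ⟩
  (partsUpTo 2 ⋆ Q) n                                        ≡⟨ sym (shift-⋆ 3 (partsUpTo 2) Q (3 + n)) ⟩
  (shift 3 (partsUpTo 2) ⋆ Q) (3 + n)                        ≡⟨ ⋆-comm (shift 3 (partsUpTo 2)) Q (3 + n) ⟩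
  (Q ⋆ shift 3 (partsUpTo 2)) (3 + n)                        ≡⟨ ⋆-congʳ Q (3 + n) (λ t t≤3+n → sym (∑-Pφ*positiveMultiples n t t≤3+n)) ⟩
  (Q ⋆ (λ t → ∑ (suc n) (λ i → Pφ (3 + i) * positiveMultiples (3 + i) t))) (3 + n)
                                                             ≡⟨ ⋆-∑ Q (suc n) (Pφ ∘ (3 +_)) (positiveMultiples ∘ (3 +_)) (3 + n) ⟩
  ∑ (suc n) (λ i → Pφ (3 + i) * (Q ⋆ positiveMultiples (3 + i)) (3 + n))
                                                             ≡⟨ ∑-cong (suc n) (λ i i<1+n → cong (Pφ (3 + i) *_) (sym (S≡coefficient n i (s≤s⁻¹ i<1+n)))) ⟩
  ∑ (suc n) (λ i → Pφ (3 + i) * S 3 (3 + n) (3 + i))         ≡⟨ sym (sum-map-applyUpTo (λ k → Pφ k * S 3 (3 + n) k) (3 +_) (suc n)) ⟩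
  sumFromTo 3 (3 + n) (λ k → Pφ k * S 3 (3 + n) k)           ≡⟨ cong (λ m → sumFromTo 3 m (λ k → Pφ k * S 3 m k)) (+-comm 3 n) ⟩
  sumFromTo 3 (n + 3) (λ k → Pφ k * S 3 (n + 3) k)           ∎
  where
  Q : Series
  Q = parts≥3UpTo (3 + n)
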